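{- For the complete graph $K_n$ with $n\ge 3$, $\mathrm{Maj}(K_n)=3$ if $n\ne 4$, and $\mathrm{Maj}(K_4)=4$.
   Context: A strong majority vertex-coloring of a graph $G=(V,E)$ is a (not necessarily proper) map $c:V\to C$ into a set $C$ of colors such that for every vertex $v\in V$ and every color $\alpha\in C$, at most half of the neighbors of $v$ have color $\alpha$. The strong majority number $\mathrm{Maj}(G)$ is the least number of colors in such a coloring. -}

module Defs where

open import Data.Nat using (ℕ; zero; suc; _+_; _*_; _≤_)
open import Data.Fin using (Fin; zero; suc)
open import Data.Fin.Properties using (_≟_)
open import Data.Bool using (Bool; true; false; _∧_; not; if_then_else_)
open import Data.Product using (Σ; _×_)
open import Relation.Nullary.Decidable using (⌊_⌋)
open import Relation.Binary.PropositionalEquality using (_≡_)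

count : (n : ℕ) → (Fin n → Bool) → ℕ
count zero    p = 0
count (suc n) p = (if p zero then 1 else 0) + count n (λ i → p (suc i))

record SimpleGraph (n : ℕ) : Set where
  field
    adj    : Fin n → Fin n → Bool
    sym    : ∀ u v → adj u v ≡ adj v u
    irrefl : ∀ v → adj v v ≡ false
open SimpleGraph public

completeGraph : (n : ℕ) → SimpleGraph n
completeGraph n = record
  { adj    = λ u v → not ⌊ u ≟ v ⌋
  ; sym    = symP
  ; irrefl = irr }
  where
    open import Relation.Binary.PropositionalEquality using (refl) renaming (sym to ≡-sym)
    open import Relation.Nullary using (yes; no)
    symP : ∀ u v → not ⌊ u ≟ v ⌋ ≡ not ⌊ v ≟ u ⌋
    symP u v with u ≟ v | v ≟ u
    ... | yes _ | yes _ = refl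
    ... | no _  | no _  = refl
    ... | yes p | no q  with q (≡-sym p)
    ... | ()
    symP u v | no q | yes p with q (≡-sym p)
    ... | ()
    irr : ∀ v → not ⌊ v ≟ v ⌋ ≡ false
    irr v with v ≟ v
    ... | yes _ = refl
    ... | no q with q refl
    ... | ()

degree : ∀ {n} → SimpleGraph n → Fin n → ℕ
degree {n} G v = count n (λ u → adj G v u)

colourDegree : ∀ {n k} → SimpleGraph n → (Fin n → Fin k) → Fin n → Fin k → ℕ
colourDegree {n} G c v α = count n (λ u → adj G v u ∧ ⌊ c u ≟ α ⌋)

IsStrongMajorityColouring : ∀ {n k} → SimpleGraph n → (Fin n → Fin k) → Set
IsStrongMajorityColouring G c =
  ∀ v α → 2 * colourDegree G c v α ≤ degree G v

HasStrongMajorityColouring : ∀ {n} → SimpleGraph n → ℕ → Set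
HasStrongMajorityColouring {n} G k =
  Σ (Fin n → Fin k) (λ c → IsStrongMajorityColouring G c)

MajEq : ∀ {n} → SimpleGraph n → ℕ → Set
MajEq G k = HasStrongMajorityColouring G k
          × (∀ m → HasStrongMajorityColouring G m → k ≤ m)

{-# OPTIONS --safe #-}
module Submission where

-- In K_n the neighbours of v with colour α are the vertices of colour α other than v, so for
-- n ≥ 2 a colouring is a strong majority colouring exactly when every colour class has fewer
-- than n/2 vertices, i.e. at most ⌊(n-1)/2⌋. Counting the vertices class by class then gives
-- n ≤ k ⌊(n-1)/2⌋ for k colours, which rules out k ≤ 2 when n ≥ 3 and k = 3 when n = 4.
-- Conversely the cyclic colouring 0,1,2,0,1,2,… has small classes for n = 3, 5, 7, and
-- appending three vertices of distinct colours preserves this.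

open import Defs hiding (sym)
open import Data.Bool using (Bool; true; false; _∧_; not; if_then_else_)
open import Data.Bool.Properties using (∧-identityʳ)
open import Data.Fin using (Fin; zero; suc)
open import Data.Fin.Patterns using (0F; 1F; 2F)
open import Data.Fin.Properties using (_≟_; all?; ¬∀⟶∃¬)
open import Data.Nat
  using (ℕ; zero; suc; pred; _+_; _*_; _≤_; _<_; _≤?_; _<?_; ⌊_/2⌋; ⌈_/2⌉; z≤n; s≤s; s≤s⁻¹; z<s)
open import Data.Nat.Properties
  using (+-0-commutativeMonoid; +-commutativeSemigroup; +-identityʳ; *-identityʳ; *-suc;
         +-mono-≤; +-monoʳ-≤; *-monoʳ-≤; *-monoˡ-≤; ≤-trans; <⇒≤; <⇒≤pred; <⇒≱; ≰⇒>;
         m≤n+m; m<m+n; n<1+n; n≤1+n; ⌊n/2⌋-mono; ⌊n/2⌋≤⌈n/2⌉; ⌊n/2⌋+⌈n/2⌉≡n; n≡⌊n+n/2⌋;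
         module ≤-Reasoning)
open import Data.Product using (_×_; _,_)
open import Function using (id; _∘_)
open import Relation.Nullary using (¬_; Dec; yes; no; contradiction)
open import Relation.Nullary.Decidable
  using (⌊_⌋; isYes≗does; ⌊⌋-map′; dec-true; dec-false; from-yes)
open import Relation.Binary.PropositionalEquality
  using (_≡_; refl; sym; trans; cong; cong₂; subst; module ≡-Reasoning)

open import Algebra.Properties.CommutativeMonoid.Sum +-0-commutativeMonoid
  using (sum-syntax; sum-cong-≗; ∑-comm)
open import Algebra.Properties.CommutativeSemigroup +-commutativeSemigroup using (x∙yz≈y∙xz)

private
  variable
    n k : ℕ

indicator : Bool → ℕ
indicator b = if b then 1 else 0

classSize : (Fin n → Fin k) → Fin k → ℕ
classSize {n} c α = count n (λ u → ⌊ c u ≟ α ⌋)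

Balanced : (Fin n → Fin k) → Set
Balanced {n} c = ∀ α → 2 * classSize c α < n

balanced? : (c : Fin n → Fin k) → Dec (Balanced c)
balanced? {n} c = all? (λ α → 2 * classSize c α <? n)

count-cong : {p q : Fin n → Bool} → (∀ u → p u ≡ q u) → count n p ≡ count n q
count-cong {zero}  p≗q = refl
count-cong {suc n} p≗q = cong₂ _+_ (cong indicator (p≗q zero)) (count-cong (p≗q ∘ suc))

count-true : count n (λ _ → true) ≡ n
count-true {zero}  = refl
count-true {suc n} = cong suc count-true

count-false : count n (λ _ → false) ≡ 0
count-false {zero}  = refl
count-false {suc n} = count-false {n}

count≡∑ : (p : Fin n → Bool) → count n p ≡ ∑[ u < n ] indicator (p u)
count≡∑ {zero}  p = refl
count≡∑ {suc n} p = cong (indicator (p zero) +_) (count≡∑ (p ∘ suc))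

count-singleton : (v : Fin n) → count n (λ u → ⌊ v ≟ u ⌋) ≡ 1
count-singleton {suc n} zero    = cong suc (count-false {n})
count-singleton {suc n} (suc v) = trans (count-cong (λ u → ⌊⌋-map′ _ _ (v ≟ u))) (count-singleton v)

count-remove : (v : Fin n) (p : Fin n → Bool) →
               indicator (p v) + count n (λ u → not ⌊ v ≟ u ⌋ ∧ p u) ≡ count n p
count-remove {suc n} zero    p = refl
count-remove {suc n} (suc v) p = begin
  [pᵥ] + ([p₀] + count n (λ u → not ⌊ suc v ≟ suc u ⌋ ∧ p (suc u)))
    ≡⟨ x∙yz≈y∙xz [pᵥ] [p₀] _ ⟩
  [p₀] + ([pᵥ] + count n (λ u → not ⌊ suc v ≟ suc u ⌋ ∧ p (suc u)))
    ≡⟨ cong (λ m → [p₀] + ([pᵥ] + m)) (count-cong ⌊suc≟suc⌋-∧) ⟩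
  [p₀] + ([pᵥ] + count n (λ u → not ⌊ v ≟ u ⌋ ∧ p (suc u)))
    ≡⟨ cong ([p₀] +_) (count-remove v (p ∘ suc)) ⟩
  [p₀] + count n (p ∘ suc)
    ∎
  where
  open ≡-Reasoning
  [p₀] [pᵥ] : ℕ
  [p₀] = indicator (p zero)
  [pᵥ] = indicator (p (suc v))
  ⌊suc≟suc⌋-∧ : ∀ u → not ⌊ suc v ≟ suc u ⌋ ∧ p (suc u) ≡ not ⌊ v ≟ u ⌋ ∧ p (suc u)
  ⌊suc≟suc⌋-∧ u = cong (λ b → not b ∧ p (suc u)) (⌊⌋-map′ _ _ (v ≟ u))

∑-classSize : (c : Fin n → Fin k) → ∑[ α < k ] classSize c α ≡ n
∑-classSize {n} {k} c = begin
  ∑[ α < k ] classSize c α                    ≡⟨ sum-cong-≗ (λ α → count≡∑ (λ u → ⌊ c u ≟ α ⌋)) ⟩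
  ∑[ α < k ] ∑[ u < n ] indicator ⌊ c u ≟ α ⌋  ≡⟨ ∑-comm (λ α u → indicator ⌊ c u ≟ α ⌋) ⟩
  ∑[ u < n ] ∑[ α < k ] indicator ⌊ c u ≟ α ⌋  ≡⟨ sum-cong-≗ ∑-indicator≡1 ⟩
  ∑[ u < n ] 1                                ≡⟨ sym (count≡∑ {n} (λ _ → true)) ⟩
  count n (λ _ → true)                        ≡⟨ count-true {n} ⟩
  n                                           ∎
  where
  open ≡-Reasoning
  ∑-indicator≡1 : ∀ u → ∑[ α < k ] indicator ⌊ c u ≟ α ⌋ ≡ 1
  ∑-indicator≡1 u = trans (sym (count≡∑ (λ α → ⌊ c u ≟ α ⌋))) (count-singleton (c u))

∑-≤ : ∀ {b} (f : Fin k → ℕ) → (∀ i → f i ≤ b) → ∑[ i < k ] f i ≤ k * b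
∑-≤ {zero}  f f≤b = z≤n
∑-≤ {suc k} f f≤b = +-mono-≤ (f≤b zero) (∑-≤ (f ∘ suc) (f≤b ∘ suc))

pigeonhole : ∀ {b} (c : Fin n → Fin k) → (∀ α → classSize c α ≤ b) → n ≤ k * b
pigeonhole c classSize≤b = subst (_≤ _) (∑-classSize c) (∑-≤ (classSize c) classSize≤b)

2*m≤n⇒m≤⌊n/2⌋ : ∀ {m n} → 2 * m ≤ n → m ≤ ⌊ n /2⌋
2*m≤n⇒m≤⌊n/2⌋ {m} {n} 2m≤n =
  subst (_≤ ⌊ n /2⌋) (sym (n≡⌊n+n/2⌋ m)) (⌊n/2⌋-mono (subst (_≤ n) (cong (m +_) (+-identityʳ m)) 2m≤n))

2*⌊n/2⌋≤n : ∀ n → 2 * ⌊ n /2⌋ ≤ n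
2*⌊n/2⌋≤n n = begin
  ⌊ n /2⌋ + (⌊ n /2⌋ + 0)  ≡⟨ cong (⌊ n /2⌋ +_) (+-identityʳ ⌊ n /2⌋) ⟩
  ⌊ n /2⌋ + ⌊ n /2⌋        ≤⟨ +-monoʳ-≤ ⌊ n /2⌋ (⌊n/2⌋≤⌈n/2⌉ n) ⟩
  ⌊ n /2⌋ + ⌈ n /2⌉        ≡⟨ ⌊n/2⌋+⌈n/2⌉≡n n ⟩
  n                        ∎
  where open ≤-Reasoning

2*m≰m : ∀ {m} → 0 < m → ¬ 2 * m ≤ m
2*m≰m {suc m} _ = <⇒≱ (m<m+n (suc m) z<s)

colourDegree-monochromatic : ∀ (G : SimpleGraph n) (c : Fin n → Fin k) {α} →
                             (∀ u → c u ≡ α) → ∀ v → colourDegree G c v α ≡ degree G v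
colourDegree-monochromatic G c {α} c≡α v = count-cong λ u →
  trans (cong (adj G v u ∧_) (trans (isYes≗does (c u ≟ α)) (dec-true (c u ≟ α) (c≡α u)))) (∧-identityʳ _)

suc-degree-complete : (v : Fin n) → suc (degree (completeGraph n) v) ≡ n
suc-degree-complete {n} v = begin
  suc (degree (completeGraph n) v)          ≡⟨ cong suc (count-cong (λ u → sym (∧-identityʳ (not ⌊ v ≟ u ⌋)))) ⟩
  suc (count n (λ u → not ⌊ v ≟ u ⌋ ∧ true)) ≡⟨ count-remove v (λ _ → true) ⟩
  count n (λ _ → true)                      ≡⟨ count-true ⟩
  n                                         ∎
  where open ≡-Reasoning

colourDegree-complete : (c : Fin n → Fin k) (v : Fin n) (α : Fin k) →
                        indicator ⌊ c v ≟ α ⌋ + colourDegree (completeGraph n) c v α ≡ classSize c α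
colourDegree-complete c v α = count-remove v (λ u → ⌊ c u ≟ α ⌋)

colourDegree≤classSize : (c : Fin n → Fin k) (v : Fin n) (α : Fin k) →
                         colourDegree (completeGraph n) c v α ≤ classSize c α
colourDegree≤classSize {n} c v α =
  subst (colourDegree (completeGraph n) c v α ≤_) (colourDegree-complete c v α) (m≤n+m _ _)

balanced⇒smc : {c : Fin n → Fin k} → Balanced c → IsStrongMajorityColouring (completeGraph n) c
balanced⇒smc {n} {c = c} balanced v α = begin
  2 * colourDegree (completeGraph n) c v α
    ≤⟨ *-monoʳ-≤ 2 (colourDegree≤classSize c v α) ⟩
  2 * classSize c α
    ≤⟨ s≤s⁻¹ (subst (2 * classSize c α <_) (sym (suc-degree-complete v)) (balanced α)) ⟩
  degree (completeGraph n) v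
    ∎
  where open ≤-Reasoning

smc⇒balanced : {c : Fin n → Fin k} → 2 ≤ n → IsStrongMajorityColouring (completeGraph n) c → Balanced c
smc⇒balanced {suc n} {c = c} 2≤n smc α with all? (λ u → c u ≟ α)
... | yes c≡α =
  contradiction (subst (λ d → 2 * d ≤ d₀) (colourDegree-monochromatic K c c≡α 0F) (smc 0F α)) (2*m≰m 0<degree)
  where
  K : SimpleGraph (suc n)
  K = completeGraph (suc n)
  d₀ : ℕ
  d₀ = degree K 0F
  0<degree : 0 < d₀
  0<degree = s≤s⁻¹ (subst (2 ≤_) (sym (suc-degree-complete 0F)) 2≤n)
... | no ¬c≡α with ¬∀⟶∃¬ (suc n) _ (λ u → c u ≟ α) ¬c≡α
...   | w , cw≢α = begin-strict
  2 * classSize c α                                ≡⟨ cong (2 *_) colourDegree≡classSize ⟨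
  2 * colourDegree (completeGraph (suc n)) c w α   ≤⟨ smc w α ⟩
  degree (completeGraph (suc n)) w                 <⟨ n<1+n _ ⟩
  suc (degree (completeGraph (suc n)) w)           ≡⟨ suc-degree-complete w ⟩
  suc n                                            ∎
  where
  open ≤-Reasoning
  ⌊cw≟α⌋≡false : ⌊ c w ≟ α ⌋ ≡ false
  ⌊cw≟α⌋≡false = trans (isYes≗does (c w ≟ α)) (dec-false (c w ≟ α) cw≢α)
  colourDegree≡classSize : colourDegree (completeGraph (suc n)) c w α ≡ classSize c α
  colourDegree≡classSize =
    subst (λ b → indicator b + colourDegree (completeGraph (suc n)) c w α ≡ classSize c α)
          ⌊cw≟α⌋≡false (colourDegree-complete c w α)

balanced⇒classSize≤ : {c : Fin n → Fin k} → Balanced c → ∀ α → classSize c α ≤ ⌊ pred n /2⌋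
balanced⇒classSize≤ balanced α = 2*m≤n⇒m≤⌊n/2⌋ (<⇒≤pred (balanced α))

n≤colours*⌊pred[n]/2⌋ : 2 ≤ n → HasStrongMajorityColouring (completeGraph n) k → n ≤ k * ⌊ pred n /2⌋
n≤colours*⌊pred[n]/2⌋ 2≤n (c , smc) = pigeonhole c (balanced⇒classSize≤ (smc⇒balanced 2≤n smc))

3≤colours : 3 ≤ n → HasStrongMajorityColouring (completeGraph n) k → 3 ≤ k
3≤colours {suc n} {k} 3≤n has with k ≤? 2
... | no  k≰2 = ≰⇒> k≰2
... | yes k≤2 =
  contradiction (n≤colours*⌊pred[n]/2⌋ (≤-trans (n≤1+n 2) 3≤n) has) (<⇒≱ (begin-strict
  k * ⌊ n /2⌋  ≤⟨ *-monoˡ-≤ ⌊ n /2⌋ k≤2 ⟩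
  2 * ⌊ n /2⌋  ≤⟨ 2*⌊n/2⌋≤n n ⟩
  n            <⟨ n<1+n n ⟩
  suc n        ∎))
  where open ≤-Reasoning

4≤colours-K₄ : HasStrongMajorityColouring (completeGraph 4) k → 4 ≤ k
4≤colours-K₄ {k} has = subst (4 ≤_) (*-identityʳ k) (n≤colours*⌊pred[n]/2⌋ (s≤s (s≤s z≤n)) has)

cyclic : Fin n → Fin 3
cyclic 0F                  = 0F
cyclic 1F                  = 1F
cyclic 2F                  = 2F
cyclic (suc (suc (suc u))) = cyclic u

classSize-cyclic-+3 : ∀ α → classSize (cyclic {3 + n}) α ≡ suc (classSize (cyclic {n}) α)
classSize-cyclic-+3 0F = refl
classSize-cyclic-+3 1F = refl
classSize-cyclic-+3 2F = refl

balanced-cyclic-+3 : Balanced (cyclic {n}) → Balanced (cyclic {3 + n})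
balanced-cyclic-+3 {n} balanced α
  rewrite classSize-cyclic-+3 {n} α | *-suc 2 (classSize (cyclic {n}) α) =
    s≤s (s≤s (s≤s (<⇒≤ (balanced α))))

balanced-cyclic : ∀ n → 3 ≤ n → ¬ n ≡ 4 → Balanced (cyclic {n})
balanced-cyclic 0 () _
balanced-cyclic 1 (s≤s ()) _
balanced-cyclic 2 (s≤s (s≤s ())) _
balanced-cyclic 3 _ _   = from-yes (balanced? (cyclic {3}))
balanced-cyclic 4 _ 4≢4 = contradiction refl 4≢4
balanced-cyclic 5 _ _   = from-yes (balanced? (cyclic {5}))
balanced-cyclic 6 _ _   = balanced-cyclic-+3 (balanced-cyclic 3 (s≤s (s≤s (s≤s z≤n))) (λ ()))
balanced-cyclic 7 _ _   = from-yes (balanced? (cyclic {7}))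
balanced-cyclic (suc (suc (suc n@(suc (suc (suc (suc (suc _)))))))) _ _ =
  balanced-cyclic-+3 (balanced-cyclic n (s≤s (s≤s (s≤s z≤n))) (λ ()))

mainTheorem4 : (∀ (n : ℕ) → 3 ≤ n → ¬ (n ≡ 4) → MajEq (completeGraph n) 3)
                 × MajEq (completeGraph 4) 4
mainTheorem4 = Maj[Kₙ]≡3 , Maj[K₄]≡4
  where
  Maj[Kₙ]≡3 : ∀ (n : ℕ) → 3 ≤ n → ¬ (n ≡ 4) → MajEq (completeGraph n) 3
  Maj[Kₙ]≡3 n 3≤n n≢4 =
    (cyclic , balanced⇒smc {c = cyclic} (balanced-cyclic n 3≤n n≢4)) , λ _ → 3≤colours 3≤n
  Maj[K₄]≡4 : MajEq (completeGraph 4) 4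
  Maj[K₄]≡4 =
    (id , balanced⇒smc {c = id} (from-yes (balanced? (id {A = Fin 4})))) , λ _ → 4≤colours-K₄
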